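{- Let $\alpha>0$ and let $V$ be a set of $n$ vertices. If $G,G'$ are two graphs with $V(G),V(G')\subseteq V$ and $e(G),e(G')\ge\big(\frac59+\alpha\big)\frac{n^2}{2}$, then there are at least $\frac{\alpha^2}{3}n^3$ triples $(x,y,z)\in V^3$ such that $xyz$ is a walk in $G$ (i.e. $xy,yz\in E(G)$), $xy\in E(G')$, and $d_G(y),d_G(z)\ge\frac n3$.
   Context: $d_G(v)$ is the degree of $v$ in $G$ (zero if $v\notin V(G)$).
   Formalization: The parameter α ranges over the positive rationals. -}

module Defs where

open import Data.Nat using (ℕ; _≤_; _*_; _<_)
open import Data.Nat.ListAction using (sum)
open import Data.Bool using (Bool; true; false; if_then_else_; _∧_)
open import Data.Fin using (Fin; toℕ)
open import Data.List using (List; map; allFin; concatMap)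
open import Relation.Binary.PropositionalEquality using (_≡_)
open import Relation.Nullary.Decidable using (⌊_⌋)
import Data.Nat as ℕ

-- Vertices of V not in V(G) are simply isolated (degree 0),
-- which matches the convention d_G(v) = 0 for v ∉ V(G).
record Graph (n : ℕ) : Set where
  field
    adj   : Fin n → Fin n → Bool
    sym   : ∀ u v → adj u v ≡ adj v u
    irrefl : ∀ v → adj v v ≡ false
open Graph public

countFin : (n : ℕ) → (Fin n → Bool) → ℕ
countFin n p = sum (map (λ i → if p i then 1 else 0) (allFin n))

deg : ∀ {n} → Graph n → Fin n → ℕ
deg {n} G v = countFin n (adj G v)

edges : ∀ {n} → Graph n → ℕ
edges {n} G = sum (map (λ u → countFin n (λ v → ⌊ toℕ u ℕ.<? toℕ v ⌋ ∧ adj G u v)) (allFin n))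

-- "d_G(v) ≥ n/3", written without division: n ≤ 3 · d_G(v)
bigDeg : ∀ {n} → Graph n → Fin n → Bool
bigDeg {n} G v = ⌊ n ℕ.≤? 3 * deg G v ⌋

goodTriples : ∀ {n} → Graph n → Graph n → ℕ
goodTriples {n} G G' =
  sum (map (λ x → sum (map (λ y → countFin n (λ z →
      adj G x y ∧ adj G y z ∧ adj G' x y ∧ bigDeg G y ∧ bigDeg G z)) (allFin n))) (allFin n))

module Submission where

-- Let m = min(e(G), e(G')) and write 18m = 5n² + δ, so δ ≥ 9αn².  After
-- clearing the denominators of α (RationalForm, NaturalForm) it suffices to show
-- δ² ≤ 243·n·T, where T is the number of good triples (CountingBound).
--   Call y big if 3d(y) ≥ n and small otherwise; a big y is rich if 9n·c(y) ≥ δ,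
-- where c(y) is its number of big neighbours, and poor otherwise.  Counting good
-- triples from their middle vertex gives δ·S ≤ 9n·T, where S counts the pairs
-- (x, y) with y rich and xy ∈ E(G) ∩ E(G') (VertexClasses).  Double counting the
-- edges of G and G' according to the classes of their endpoints (Handshake,
-- VertexClasses) gives linear and quadratic relations between S, the class sizes
-- and the numbers of edges between classes.  Together with a polynomial
-- nonnegativity certificate over ℤ (Certificate, KeyInequality) they yield
-- δ ≤ 27S, hence δ² ≤ 27·δS ≤ 243·n·T.

module FiniteSum where

  open import Data.Nat using (ℕ; _+_; _*_; _≤_; z≤n)
  open import Data.Nat.Properties
  open import Data.Nat.ListAction using (sum)
  open import Data.Fin using (Fin)
  open import Data.List using (List; []; _∷_; map; allFin; length)
  open import Data.List.Properties using (length-tabulate)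
  open import Relation.Binary.PropositionalEquality
  open import Algebra.Properties.CommutativeSemigroup +-commutativeSemigroup
    using () renaming (interchange to +-interchange)

  ΣL : ∀ {A : Set} → List A → (A → ℕ) → ℕ
  ΣL xs f = sum (map f xs)

  module _ {A : Set} where

    ΣL-cong : ∀ (xs : List A) {f g : A → ℕ} → (∀ x → f x ≡ g x) → ΣL xs f ≡ ΣL xs g
    ΣL-cong []       f≗g = refl
    ΣL-cong (x ∷ xs) f≗g = cong₂ _+_ (f≗g x) (ΣL-cong xs f≗g)

    ΣL-mono : ∀ (xs : List A) {f g : A → ℕ} → (∀ x → f x ≤ g x) → ΣL xs f ≤ ΣL xs g
    ΣL-mono []       f≤g = z≤n
    ΣL-mono (x ∷ xs) f≤g = +-mono-≤ (f≤g x) (ΣL-mono xs f≤g)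

    ΣL-+ : ∀ (xs : List A) (f g : A → ℕ) → ΣL xs (λ x → f x + g x) ≡ ΣL xs f + ΣL xs g
    ΣL-+ []       f g = refl
    ΣL-+ (x ∷ xs) f g =
      trans (cong ((f x + g x) +_) (ΣL-+ xs f g)) (+-interchange (f x) (g x) (ΣL xs f) (ΣL xs g))

    ΣL-*ˡ : ∀ (xs : List A) (c : ℕ) (f : A → ℕ) → ΣL xs (λ x → c * f x) ≡ c * ΣL xs f
    ΣL-*ˡ []       c f = sym (*-zeroʳ c)
    ΣL-*ˡ (x ∷ xs) c f =
      trans (cong (c * f x +_) (ΣL-*ˡ xs c f)) (sym (*-distribˡ-+ c (f x) (ΣL xs f)))

    ΣL-*ʳ : ∀ (xs : List A) (c : ℕ) (f : A → ℕ) → ΣL xs (λ x → f x * c) ≡ ΣL xs f * c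
    ΣL-*ʳ xs c f = trans (ΣL-cong xs (λ x → *-comm (f x) c))
                         (trans (ΣL-*ˡ xs c f) (*-comm c (ΣL xs f)))

    ΣL-zero : ∀ (xs : List A) → ΣL xs (λ _ → 0) ≡ 0
    ΣL-zero []       = refl
    ΣL-zero (x ∷ xs) = ΣL-zero xs

  ΣL-swap : ∀ {A B : Set} (xs : List A) (ys : List B) (f : A → B → ℕ) →
    ΣL xs (λ x → ΣL ys (f x)) ≡ ΣL ys (λ y → ΣL xs (λ x → f x y))
  ΣL-swap []       ys f = sym (ΣL-zero ys)
  ΣL-swap (x ∷ xs) ys f =
    trans (cong (ΣL ys (f x) +_) (ΣL-swap xs ys f))
          (sym (ΣL-+ ys (f x) (λ y → ΣL xs (λ x → f x y))))

  module OverFin (n : ℕ) where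

    Σ : (Fin n → ℕ) → ℕ
    Σ = ΣL (allFin n)

    Σ-cong : {f g : Fin n → ℕ} → (∀ x → f x ≡ g x) → Σ f ≡ Σ g
    Σ-cong = ΣL-cong (allFin n)

    Σ-mono : {f g : Fin n → ℕ} → (∀ x → f x ≤ g x) → Σ f ≤ Σ g
    Σ-mono = ΣL-mono (allFin n)

    Σ-+ : (f g : Fin n → ℕ) → Σ (λ x → f x + g x) ≡ Σ f + Σ g
    Σ-+ = ΣL-+ (allFin n)

    Σ-*ˡ : (c : ℕ) (f : Fin n → ℕ) → Σ (λ x → c * f x) ≡ c * Σ f
    Σ-*ˡ = ΣL-*ˡ (allFin n)

    Σ-*ʳ : (c : ℕ) (f : Fin n → ℕ) → Σ (λ x → f x * c) ≡ Σ f * c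
    Σ-*ʳ = ΣL-*ʳ (allFin n)

    Σ-swap : (f : Fin n → Fin n → ℕ) → Σ (λ x → Σ (f x)) ≡ Σ (λ y → Σ (λ x → f x y))
    Σ-swap = ΣL-swap (allFin n) (allFin n)

    Σ-const : (c : ℕ) → Σ (λ _ → c) ≡ n * c
    Σ-const c = trans (const-list (allFin n)) (cong (_* c) (length-tabulate {n = n} (λ i → i)))
      where
      const-list : ∀ (xs : List (Fin n)) → ΣL xs (λ _ → c) ≡ length xs * c
      const-list []       = refl
      const-list (x ∷ xs) = cong (c +_) (const-list xs)


module Indicator where

  open import Data.Nat using (ℕ; _≤_; _<_; _*_; _+_; _≤?_; _≤ᵇ_; z≤n; s≤s)
  open import Data.Nat.Properties using (≰⇒>; ≤ᵇ⇒≤)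
  open import Data.Bool using (Bool; true; false; if_then_else_; _∧_; not; T)
  open import Data.Unit using (tt)
  open import Relation.Binary.PropositionalEquality using (_≡_; refl)
  open import Relation.Nullary.Decidable using (⌊_⌋; yes; no)

  ι : Bool → ℕ
  ι b = if b then 1 else 0

  ι≤1 : ∀ p → ι p ≤ 1
  ι≤1 true  = s≤s z≤n
  ι≤1 false = z≤n

  ι-∧ : ∀ p q → ι (p ∧ q) ≡ ι p * ι q
  ι-∧ true  true  = refl
  ι-∧ true  false = refl
  ι-∧ false q     = refl

  ι-split : ∀ p h → ι p ≡ ι (p ∧ h) + ι (p ∧ not h)
  ι-split true  true  = refl
  ι-split true  false = refl
  ι-split false h     = refl

  ι-not : ∀ p → ι (not p) + ι p ≡ 1
  ι-not true  = refl
  ι-not false = refl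

  ≤?-true : ∀ m n → ⌊ m ≤? n ⌋ ≡ true → m ≤ n
  ≤?-true m n eq with m ≤? n
  ... | yes m≤n = m≤n
  ≤?-true m n () | no _

  ≤?-false : ∀ m n → ⌊ m ≤? n ⌋ ≡ false → n < m
  ≤?-false m n eq with m ≤? n
  ≤?-false m n () | yes _
  ... | no m≰n = ≰⇒> m≰n

  evaluate : ∀ {m n} → T (m ≤ᵇ n) → m ≤ n
  evaluate {m} {n} = ≤ᵇ⇒≤ m n

  ι-union : ∀ p q → ι p + ι q ≤ ι p * ι q + 1
  ι-union true  true  = evaluate tt
  ι-union true  false = evaluate tt
  ι-union false true  = evaluate tt
  ι-union false false = evaluate tt

  ι-*-≤ˡ : ∀ p q → ι p * ι q ≤ ι p
  ι-*-≤ˡ true  true  = evaluate tt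
  ι-*-≤ˡ true  false = evaluate tt
  ι-*-≤ˡ false q     = z≤n


module Handshake where

  open import Defs using (Graph; adj; deg; edges)
  open FiniteSum
  open Indicator
  open import Data.Nat
  open import Data.Nat.Properties
  open import Data.Bool using (_∧_)
  open import Data.Fin using (Fin; toℕ)
  open import Data.Empty using (⊥-elim)
  open import Relation.Binary.PropositionalEquality
  open import Relation.Nullary.Decidable using (⌊_⌋; yes; no)

  module _ {n : ℕ} (G : Graph n) where
    open OverFin n

    private
      below : Fin n → Fin n → ℕ
      below u v = ι (⌊ toℕ u <? toℕ v ⌋ ∧ adj G u v)

      below-both : ∀ u v → below u v + below v u ≤ ι (adj G u v)
      below-both u v with toℕ u <? toℕ v | toℕ v <? toℕ u
      ... | yes u<v | yes v<u = ⊥-elim (<-asym u<v v<u)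
      ... | yes _   | no _    = ≤-reflexive (+-identityʳ _)
      ... | no _    | yes _   = ≤-reflexive (cong ι (Graph.sym G v u))
      ... | no _    | no _    = z≤n

    handshake : 2 * edges G ≤ Σ (deg G)
    handshake = begin
      2 * edges G                                        ≡⟨ cong (edges G +_) (+-identityʳ (edges G)) ⟩
      edges G + edges G                                  ≡⟨ cong (edges G +_) (Σ-swap below) ⟩
      Σ (λ u → Σ (below u)) + Σ (λ u → Σ (λ v → below v u)) ≡⟨ sym (Σ-+ _ _) ⟩
      Σ (λ u → Σ (below u) + Σ (λ v → below v u))        ≡⟨ Σ-cong (λ u → sym (Σ-+ _ _)) ⟩
      Σ (λ u → Σ (λ v → below u v + below v u))          ≤⟨ Σ-mono (λ u → Σ-mono (below-both u)) ⟩
      Σ (deg G)                                          ∎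
      where open ≤-Reasoning

    deg≤n : ∀ v → deg G v ≤ n
    deg≤n v = begin
      Σ (λ z → ι (adj G v z)) ≤⟨ Σ-mono (λ z → ι≤1 (adj G v z)) ⟩
      Σ (λ _ → 1)             ≡⟨ Σ-const 1 ⟩
      n * 1                   ≡⟨ *-identityʳ n ⟩
      n                       ∎
      where open ≤-Reasoning

    degree-sum≤n² : Σ (deg G) ≤ n * n
    degree-sum≤n² = ≤-trans (Σ-mono deg≤n) (≤-reflexive (Σ-const n))


module VertexClasses where

  open import Defs using (Graph; adj; deg; bigDeg; goodTriples)
  open FiniteSum
  open Indicator
  open import Data.Nat
  open import Data.Nat.Properties
  open import Data.Bool using (Bool; true; false; _∧_; not)
  open import Data.Unit using (tt)
  open import Data.Fin using (Fin)
  open import Data.Empty using (⊥-elim)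
  open import Relation.Binary.PropositionalEquality
  open import Relation.Nullary.Decidable using (⌊_⌋)
  open import Data.Nat.Tactic.RingSolver using (solve-∀)

  module VertexSplit {n : ℕ} (G G' : Graph n) (δ : ℕ) where
    open OverFin n

    g g' : Fin n → Fin n → ℕ
    g  x y = ι (adj G x y)
    g' x y = ι (adj G' x y)

    g-sym : ∀ x y → g x y ≡ g y x
    g-sym x y = cong ι (Graph.sym G x y)

    g'-sym : ∀ x y → g' x y ≡ g' y x
    g'-sym x y = cong ι (Graph.sym G' x y)

    big small : Fin n → ℕ
    big   y = ι (bigDeg G y)
    small y = ι (not (bigDeg G y))

    bigNbrs smallNbrs common : Fin n → ℕ
    bigNbrs   y = Σ (λ z → g y z * big z)
    smallNbrs y = Σ (λ z → g y z * small z)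
    common    y = Σ (λ x → g x y * g' x y)

    isRich : Fin n → Bool
    isRich y = ⌊ δ ≤? 9 * n * bigNbrs y ⌋

    rich poor : Fin n → ℕ
    rich y = ι (bigDeg G y ∧ isRich y)
    poor y = ι (bigDeg G y ∧ not (isRich y))

    nSmall nBig nRich nPoor : ℕ
    nSmall = Σ small
    nBig   = Σ big
    nRich  = Σ rich
    nPoor  = Σ poor

    commonBig commonRich : ℕ
    commonBig  = Σ (λ y → common y * big y)
    commonRich = Σ (λ y → common y * rich y)

    pairsSS pairsSB pairsPB pairsPS : ℕ
    pairsSS = Σ (λ y → small y * smallNbrs y)
    pairsSB = Σ (λ y → small y * bigNbrs y)
    pairsPB = Σ (λ y → poor y * bigNbrs y)
    pairsPS = Σ (λ y → poor y * smallNbrs y)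

    small+big : ∀ y → small y + big y ≡ 1
    small+big y = ι-not (bigDeg G y)

    big≡rich+poor : ∀ y → big y ≡ rich y + poor y
    big≡rich+poor y = ι-split (bigDeg G y) (isRich y)

    split-by-size : ∀ y u → u ≡ u * small y + u * big y
    split-by-size y u = begin
      u                       ≡⟨ sym (*-identityʳ u) ⟩
      u * 1                   ≡⟨ cong (u *_) (sym (small+big y)) ⟩
      u * (small y + big y)   ≡⟨ *-distribˡ-+ u (small y) (big y) ⟩
      u * small y + u * big y ∎
      where open ≡-Reasoning

    degree-split : ∀ y → deg G y ≡ bigNbrs y + smallNbrs y
    degree-split y =
      trans (Σ-cong (λ z → trans (split-by-size z (g y z)) (+-comm (g y z * small z) _))) (Σ-+ _ _)

    nSmall+nBig : nSmall + nBig ≡ n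
    nSmall+nBig = trans (sym (Σ-+ small big)) (trans (Σ-cong small+big) (trans (Σ-const 1) (*-identityʳ n)))

    nRich+nPoor : nRich + nPoor ≡ nBig
    nRich+nPoor = trans (sym (Σ-+ rich poor)) (sym (Σ-cong big≡rich+poor))

    private
      zero-≤ : ∀ {x y} → x ≡ 0 → x ≤ y
      zero-≤ refl = z≤n

    -- Good triples counted from their middle vertex y: x ranges over the common
    -- neighbours of y, and z over the big neighbours of a big y.
    goodTriples≡ : goodTriples G G' ≡ Σ (λ y → common y * (big y * bigNbrs y))
    goodTriples≡ = begin
      goodTriples G G'                                            ≡⟨ Σ-cong (λ x → Σ-cong (fixed-xy x)) ⟩
      Σ (λ x → Σ (λ y → (g x y * g' x y) * (big y * bigNbrs y))) ≡⟨ Σ-swap _ ⟩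
      Σ (λ y → Σ (λ x → (g x y * g' x y) * (big y * bigNbrs y))) ≡⟨ Σ-cong (λ y → Σ-*ʳ _ (λ x → g x y * g' x y)) ⟩
      Σ (λ y → common y * (big y * bigNbrs y))                    ∎
      where
      open ≡-Reasoning
      ι-∧⁵ : ∀ P Q R U V → ι (P ∧ Q ∧ R ∧ U ∧ V) ≡ ((ι P * ι R) * ι U) * (ι Q * ι V)
      ι-∧⁵ P Q R U V = begin
        ι (P ∧ Q ∧ R ∧ U ∧ V)             ≡⟨ ι-∧ P _ ⟩
        ι P * ι (Q ∧ R ∧ U ∧ V)           ≡⟨ cong (ι P *_) (trans (ι-∧ Q _) (cong (ι Q *_) (trans (ι-∧ R _) (cong (ι R *_) (ι-∧ U V))))) ⟩
        ι P * (ι Q * (ι R * (ι U * ι V))) ≡⟨ rearrange (ι P) (ι Q) (ι R) (ι U) (ι V) ⟩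
        ((ι P * ι R) * ι U) * (ι Q * ι V) ∎
        where
        rearrange : ∀ p q r u v → p * (q * (r * (u * v))) ≡ ((p * r) * u) * (q * v)
        rearrange = solve-∀
      fixed-xy : ∀ x y → Σ (λ z → ι (adj G x y ∧ adj G y z ∧ adj G' x y ∧ bigDeg G y ∧ bigDeg G z))
                         ≡ (g x y * g' x y) * (big y * bigNbrs y)
      fixed-xy x y = begin
        Σ (λ z → ι (adj G x y ∧ adj G y z ∧ adj G' x y ∧ bigDeg G y ∧ bigDeg G z))
          ≡⟨ Σ-cong (λ z → ι-∧⁵ (adj G x y) (adj G y z) (adj G' x y) (bigDeg G y) (bigDeg G z)) ⟩
        Σ (λ z → ((g x y * g' x y) * big y) * (g y z * big z)) ≡⟨ Σ-*ˡ ((g x y * g' x y) * big y) (λ z → g y z * big z) ⟩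
        ((g x y * g' x y) * big y) * bigNbrs y                 ≡⟨ *-assoc (g x y * g' x y) (big y) (bigNbrs y) ⟩
        (g x y * g' x y) * (big y * bigNbrs y)                 ∎

    -- Each rich middle vertex contributes at least δ/9n choices of z.
    richCommon-bound : δ * commonRich ≤ 9 * n * goodTriples G G'
    richCommon-bound = begin
      δ * commonRich                                     ≡⟨ sym (Σ-*ˡ δ _) ⟩
      Σ (λ y → δ * (common y * rich y))                  ≤⟨ Σ-mono (λ y → at y (bigDeg G y) (isRich y) (≤?-true δ _)) ⟩
      Σ (λ y → 9 * n * (common y * (big y * bigNbrs y))) ≡⟨ Σ-*ˡ (9 * n) _ ⟩
      9 * n * Σ (λ y → common y * (big y * bigNbrs y))   ≡⟨ cong (9 * n *_) (sym goodTriples≡) ⟩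
      9 * n * goodTriples G G'                           ∎
      where
      open ≤-Reasoning
      at : ∀ y B h → (h ≡ true → δ ≤ 9 * n * bigNbrs y) →
           δ * (common y * ι (B ∧ h)) ≤ 9 * n * (common y * (ι B * bigNbrs y))
      at y false h       _       = zero-≤ (trans (cong (δ *_) (*-zeroʳ (common y))) (*-zeroʳ δ))
      at y true  false   _       = zero-≤ (trans (cong (δ *_) (*-zeroʳ (common y))) (*-zeroʳ δ))
      at y true  true    rich⇒ = begin
        δ * (common y * 1)                      ≡⟨ cong (δ *_) (*-identityʳ (common y)) ⟩
        δ * common y                            ≤⟨ *-monoˡ-≤ (common y) (rich⇒ refl) ⟩
        9 * n * bigNbrs y * common y            ≡⟨ reorder (9 * n) (bigNbrs y) (common y) ⟩
        9 * n * (common y * (1 * bigNbrs y))    ∎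
        where
        reorder : ∀ u v w → u * v * w ≡ u * (w * (1 * v))
        reorder = solve-∀

    -- Inclusion–exclusion for E(G) ∪ E(G'), summed over all ordered pairs.
    union-bound : Σ (deg G) + Σ (deg G') ≤ Σ common + n * n
    union-bound = begin
      Σ (deg G) + Σ (deg G')                 ≡⟨ sym (Σ-+ _ _) ⟩
      Σ (λ y → deg G y + deg G' y)           ≡⟨ Σ-cong (λ y → sym (Σ-+ _ _)) ⟩
      Σ (λ y → Σ (λ x → g y x + g' y x))     ≤⟨ Σ-mono (λ y → Σ-mono (λ x → pair x y)) ⟩
      Σ (λ y → Σ (λ x → g x y * g' x y + 1)) ≡⟨ Σ-cong (λ y → Σ-+ _ _) ⟩
      Σ (λ y → common y + Σ (λ _ → 1))       ≡⟨ Σ-+ _ _ ⟩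
      Σ common + Σ (λ _ → Σ (λ _ → 1))       ≡⟨ cong (Σ common +_) (trans (Σ-const _) (cong (n *_) (trans (Σ-const 1) (*-identityʳ n)))) ⟩
      Σ common + n * n                       ∎
      where
      open ≤-Reasoning
      pair : ∀ x y → g y x + g' y x ≤ g x y * g' x y + 1
      pair x y rewrite g-sym y x | g'-sym y x = ι-union (adj G x y) (adj G' x y)

    -- A common edge xy at a small y is either small–small or is counted at the big x.
    common-bound : Σ common ≤ commonBig + commonBig + pairsSS
    common-bound = begin
      Σ common                                           ≡⟨ Σ-cong (λ y → split-by-size y (common y)) ⟩
      Σ (λ y → common y * small y + common y * big y)    ≡⟨ Σ-+ _ _ ⟩
      Σ (λ y → common y * small y) + commonBig           ≤⟨ +-monoˡ-≤ commonBig commonSmall-bound ⟩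
      pairsSS + commonBig + commonBig                    ≡⟨ rotate pairsSS commonBig ⟩
      commonBig + commonBig + pairsSS                    ∎
      where
      open ≤-Reasoning
      rotate : ∀ p c → p + c + c ≡ c + c + p
      rotate = solve-∀
      edge : ∀ P Q By Bx → ι P * ι Q * ι (not By) ≤ ι (not By) * (ι P * ι (not Bx)) + ι Bx * (ι P * ι Q)
      edge true  true  true  Bx    = z≤n
      edge true  true  false true  = evaluate tt
      edge true  true  false false = evaluate tt
      edge true  false By    Bx    = z≤n
      edge false Q     By    Bx    = z≤n
      pair : ∀ x y → g x y * g' x y * small y ≤ small y * (g y x * small x) + big x * (g y x * g' y x)
      pair x y rewrite g-sym y x | g'-sym y x = edge (adj G x y) (adj G' x y) (bigDeg G y) (bigDeg G x)
      commonSmall-bound : Σ (λ y → common y * small y) ≤ pairsSS + commonBig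
      commonSmall-bound = begin
        Σ (λ y → common y * small y)                     ≡⟨ Σ-cong (λ y → sym (Σ-*ʳ (small y) _)) ⟩
        Σ (λ y → Σ (λ x → g x y * g' x y * small y))     ≤⟨ Σ-mono (λ y → Σ-mono (λ x → pair x y)) ⟩
        Σ (λ y → Σ (λ x → small y * (g y x * small x) + big x * (g y x * g' y x)))
          ≡⟨ trans (Σ-cong (λ y → Σ-+ _ _)) (Σ-+ _ _) ⟩
        Σ (λ y → Σ (λ x → small y * (g y x * small x))) + Σ (λ y → Σ (λ x → big x * (g y x * g' y x)))
          ≡⟨ cong₂ _+_ (Σ-cong (λ y → Σ-*ˡ (small y) _)) (Σ-swap _) ⟩
        pairsSS + Σ (λ x → Σ (λ y → big x * (g y x * g' y x)))
          ≡⟨ cong (pairsSS +_) (Σ-cong (λ x → trans (Σ-*ˡ (big x) _) (*-comm (big x) (common x)))) ⟩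
        pairsSS + commonBig                              ∎

    common≤deg : ∀ y → common y ≤ deg G y
    common≤deg y = Σ-mono edge
      where
      edge : ∀ x → g x y * g' x y ≤ g y x
      edge x rewrite g-sym y x = ι-*-≤ˡ (adj G x y) (adj G' x y)

    -- At a poor y, the common edges are bounded by all edges, big or small.
    commonBig-bound : commonBig ≤ commonRich + pairsPB + pairsPS
    commonBig-bound = begin
      commonBig                                         ≡⟨ Σ-cong (λ y → trans (cong (common y *_) (big≡rich+poor y)) (*-distribˡ-+ (common y) (rich y) (poor y))) ⟩
      Σ (λ y → common y * rich y + common y * poor y)   ≡⟨ Σ-+ _ _ ⟩
      commonRich + Σ (λ y → common y * poor y)          ≤⟨ +-monoʳ-≤ commonRich (Σ-mono at-poor) ⟩
      commonRich + Σ (λ y → poor y * bigNbrs y + poor y * smallNbrs y) ≡⟨ cong (commonRich +_) (Σ-+ _ _) ⟩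
      commonRich + (pairsPB + pairsPS)                  ≡⟨ sym (+-assoc commonRich pairsPB pairsPS) ⟩
      commonRich + pairsPB + pairsPS                    ∎
      where
      open ≤-Reasoning
      at-poor : ∀ y → common y * poor y ≤ poor y * bigNbrs y + poor y * smallNbrs y
      at-poor y = begin
        common y * poor y                       ≤⟨ *-monoˡ-≤ (poor y) (common≤deg y) ⟩
        deg G y * poor y                        ≡⟨ cong (_* poor y) (degree-split y) ⟩
        (bigNbrs y + smallNbrs y) * poor y      ≡⟨ *-comm _ (poor y) ⟩
        poor y * (bigNbrs y + smallNbrs y)      ≡⟨ *-distribˡ-+ (poor y) (bigNbrs y) (smallNbrs y) ⟩
        poor y * bigNbrs y + poor y * smallNbrs y ∎

    smallDegrees≡ : pairsSS + pairsSB ≡ Σ (λ y → small y * deg G y)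
    smallDegrees≡ = trans (sym (Σ-+ _ _)) (Σ-cong at)
      where
      at : ∀ y → small y * smallNbrs y + small y * bigNbrs y ≡ small y * deg G y
      at y = trans (sym (*-distribˡ-+ (small y) (smallNbrs y) (bigNbrs y)))
                   (cong (small y *_) (trans (+-comm (smallNbrs y) (bigNbrs y)) (sym (degree-split y))))

    -- Small vertices have degree < n/3.
    small-degrees : 3 * (pairsSS + pairsSB) ≤ nSmall * n
    small-degrees = begin
      3 * (pairsSS + pairsSB)               ≡⟨ cong (3 *_) smallDegrees≡ ⟩
      3 * Σ (λ y → small y * deg G y)       ≡⟨ sym (Σ-*ˡ 3 _) ⟩
      Σ (λ y → 3 * (small y * deg G y))     ≤⟨ Σ-mono (λ y → at (bigDeg G y) (deg G y) (≤?-false n (3 * deg G y))) ⟩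
      Σ (λ y → small y * n)                 ≡⟨ Σ-*ʳ n small ⟩
      nSmall * n                            ∎
      where
      open ≤-Reasoning
      at : ∀ B x → (B ≡ false → 3 * x < n) → 3 * (ι (not B) * x) ≤ ι (not B) * n
      at true  x _      = z≤n
      at false x small⇒ = begin
        3 * (1 * x) ≡⟨ cong (3 *_) (*-identityˡ x) ⟩
        3 * x       ≤⟨ <⇒≤ (small⇒ refl) ⟩
        n           ≡⟨ sym (*-identityˡ n) ⟩
        1 * n       ∎

    -- Edges between big and small vertices, counted from either end.
    bigSmall≡smallBig : Σ (λ y → big y * smallNbrs y) ≡ pairsSB
    bigSmall≡smallBig = begin
      Σ (λ y → big y * smallNbrs y)                      ≡⟨ Σ-cong (λ y → sym (Σ-*ˡ (big y) _)) ⟩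
      Σ (λ y → Σ (λ z → big y * (g y z * small z)))      ≡⟨ Σ-swap _ ⟩
      Σ (λ z → Σ (λ y → big y * (g y z * small z)))      ≡⟨ Σ-cong (λ z → Σ-cong (λ y → flip y z)) ⟩
      Σ (λ z → Σ (λ y → small z * (g z y * big y)))      ≡⟨ Σ-cong (λ z → Σ-*ˡ (small z) _) ⟩
      pairsSB                                            ∎
      where
      open ≡-Reasoning
      flip : ∀ y z → big y * (g y z * small z) ≡ small z * (g z y * big y)
      flip y z rewrite g-sym y z = reorder (big y) (g z y) (small z)
        where
        reorder : ∀ u v w → u * (v * w) ≡ w * (v * u)
        reorder = solve-∀

    -- A big neighbour of a rich vertex is rich (counted in nRich²) or poor
    -- (counted, from its own side, in pairsPB).
    richBig-bound : Σ (λ y → rich y * bigNbrs y) ≤ nRich * nRich + pairsPB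
    richBig-bound = begin
      Σ (λ y → rich y * bigNbrs y)                             ≡⟨ Σ-cong (λ y → sym (Σ-*ˡ (rich y) _)) ⟩
      Σ (λ y → Σ (λ z → rich y * (g y z * big z)))             ≤⟨ Σ-mono (λ y → Σ-mono (λ z → pair y z)) ⟩
      Σ (λ y → Σ (λ z → rich y * rich z + poor z * (g z y * big y)))
        ≡⟨ trans (Σ-cong (λ y → Σ-+ _ _)) (Σ-+ _ _) ⟩
      Σ (λ y → Σ (λ z → rich y * rich z)) + Σ (λ y → Σ (λ z → poor z * (g z y * big y)))
        ≡⟨ cong₂ _+_ (trans (Σ-cong (λ y → Σ-*ˡ (rich y) rich)) (Σ-*ʳ nRich rich)) (Σ-swap _) ⟩
      nRich * nRich + Σ (λ z → Σ (λ y → poor z * (g z y * big y))) ≡⟨ cong (nRich * nRich +_) (Σ-cong (λ z → Σ-*ˡ (poor z) _)) ⟩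
      nRich * nRich + pairsPB                                  ∎
      where
      open ≤-Reasoning
      edge : ∀ By hy Bz hz P → ι (By ∧ hy) * (ι P * ι Bz) ≤ ι (By ∧ hy) * ι (Bz ∧ hz) + ι (Bz ∧ not hz) * (ι P * ι By)
      edge false hy    Bz    hz    P     = z≤n
      edge true  false Bz    hz    P     = z≤n
      edge true  true  true  true  true  = evaluate tt
      edge true  true  true  true  false = evaluate tt
      edge true  true  true  false true  = evaluate tt
      edge true  true  true  false false = evaluate tt
      edge true  true  false hz    true  = evaluate tt
      edge true  true  false hz    false = evaluate tt
      pair : ∀ y z → rich y * (g y z * big z) ≤ rich y * rich z + poor z * (g z y * big y)
      pair y z rewrite g-sym z y = edge (bigDeg G y) (isRich y) (bigDeg G z) (isRich z) (adj G y z)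

    bigDegrees≡ : Σ (λ y → big y * deg G y) ≡ Σ (λ y → rich y * bigNbrs y) + pairsPB + pairsSB
    bigDegrees≡ = begin
      Σ (λ y → big y * deg G y)                                      ≡⟨ Σ-cong (λ y → trans (cong (big y *_) (degree-split y)) (*-distribˡ-+ (big y) _ _)) ⟩
      Σ (λ y → big y * bigNbrs y + big y * smallNbrs y)              ≡⟨ Σ-+ _ _ ⟩
      Σ (λ y → big y * bigNbrs y) + Σ (λ y → big y * smallNbrs y)    ≡⟨ cong₂ _+_ (trans (Σ-cong split-big) (Σ-+ _ _)) bigSmall≡smallBig ⟩
      Σ (λ y → rich y * bigNbrs y) + pairsPB + pairsSB               ∎
      where
      open ≡-Reasoning
      split-big : ∀ y → big y * bigNbrs y ≡ rich y * bigNbrs y + poor y * bigNbrs y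
      split-big y = trans (cong (_* bigNbrs y) (big≡rich+poor y)) (*-distribʳ-+ (bigNbrs y) (rich y) (poor y))

    degree-sum-bound : Σ (deg G) ≤ pairsSS + pairsSB + (nRich * nRich + pairsPB + pairsPB) + pairsSB
    degree-sum-bound = begin
      Σ (deg G)                                                        ≡⟨ Σ-cong split-deg ⟩
      Σ (λ y → small y * deg G y + big y * deg G y)                    ≡⟨ Σ-+ _ _ ⟩
      Σ (λ y → small y * deg G y) + Σ (λ y → big y * deg G y)          ≡⟨ cong₂ _+_ (sym smallDegrees≡) bigDegrees≡ ⟩
      pairsSS + pairsSB + (Σ (λ y → rich y * bigNbrs y) + pairsPB + pairsSB)
        ≤⟨ +-monoʳ-≤ (pairsSS + pairsSB) (+-monoˡ-≤ pairsSB (+-monoˡ-≤ pairsPB richBig-bound)) ⟩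
      pairsSS + pairsSB + (nRich * nRich + pairsPB + pairsPB + pairsSB)
        ≡⟨ sym (+-assoc (pairsSS + pairsSB) (nRich * nRich + pairsPB + pairsPB) pairsSB) ⟩
      pairsSS + pairsSB + (nRich * nRich + pairsPB + pairsPB) + pairsSB ∎
      where
      open ≤-Reasoning
      split-deg : ∀ y → deg G y ≡ small y * deg G y + big y * deg G y
      split-deg y = trans (split-by-size y (deg G y)) (cong₂ _+_ (*-comm (deg G y) _) (*-comm (deg G y) _))

    smallNbrs≤nSmall : ∀ y → smallNbrs y ≤ nSmall
    smallNbrs≤nSmall y = Σ-mono (λ z → ≤-trans (*-monoˡ-≤ (small z) (ι≤1 (adj G y z))) (≤-reflexive (*-identityˡ (small z))))

    bigNbrs≤nBig : ∀ y → bigNbrs y ≤ nBig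
    bigNbrs≤nBig y = Σ-mono (λ z → ≤-trans (*-monoˡ-≤ (big z) (ι≤1 (adj G y z))) (≤-reflexive (*-identityˡ (big z))))

    pairsPS-bound : pairsPS ≤ nPoor * nSmall
    pairsPS-bound = ≤-trans (Σ-mono (λ y → *-monoʳ-≤ (poor y) (smallNbrs≤nSmall y))) (≤-reflexive (Σ-*ʳ nSmall poor))

    pairsSB-bound : pairsSB ≤ nSmall * nBig
    pairsSB-bound = ≤-trans (Σ-mono (λ y → *-monoʳ-≤ (small y) (bigNbrs≤nBig y))) (≤-reflexive (Σ-*ʳ nBig small))

    -- A poor vertex has fewer than δ/9n big neighbours.
    pairsPB-bound : 9 * n * pairsPB ≤ nPoor * δ
    pairsPB-bound = begin
      9 * n * pairsPB                         ≡⟨ sym (Σ-*ˡ (9 * n) _) ⟩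
      Σ (λ y → 9 * n * (poor y * bigNbrs y))  ≤⟨ Σ-mono (λ y → at (bigDeg G y) (isRich y) (bigNbrs y) (≤?-false δ _)) ⟩
      Σ (λ y → poor y * δ)                    ≡⟨ Σ-*ʳ δ poor ⟩
      nPoor * δ                               ∎
      where
      open ≤-Reasoning
      at : ∀ B h c → (h ≡ false → 9 * n * c < δ) → 9 * n * (ι (B ∧ not h) * c) ≤ ι (B ∧ not h) * δ
      at false h     c _     = zero-≤ (*-zeroʳ (9 * n))
      at true  true  c _     = zero-≤ (*-zeroʳ (9 * n))
      at true  false c poor⇒ = begin
        9 * n * (1 * c) ≡⟨ cong (9 * n *_) (*-identityˡ c) ⟩
        9 * n * c       ≤⟨ <⇒≤ (poor⇒ refl) ⟩
        δ               ≡⟨ sym (*-identityˡ δ) ⟩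
        1 * δ           ∎

    -- If few vertices are small, no big vertex can be poor: it would have
    -- fewer than n/3 neighbours.
    no-poor : 3 * δ + 27 * n * nSmall ≤ 9 * n * n → nPoor ≡ 0
    no-poor few-small = trans (Σ-cong at) (trans (Σ-const 0) (*-zeroʳ n))
      where
      at : ∀ y → poor y ≡ 0
      at y = by-cases (bigDeg G y) (isRich y) (≤?-true n (3 * deg G y)) (≤?-false δ (9 * n * bigNbrs y))
        where
        by-cases : ∀ B h → (B ≡ true → n ≤ 3 * deg G y) → (h ≡ false → 9 * n * bigNbrs y < δ) → ι (B ∧ not h) ≡ 0
        by-cases false h     _     _     = refl
        by-cases true  true  _     _     = refl
        by-cases true  false big⇒ poor⇒ = ⊥-elim (<-irrefl refl (begin-strict
          27 * n * deg G y                                  ≡⟨ trans (cong (27 * n *_) (degree-split y)) (expand n (bigNbrs y) (smallNbrs y)) ⟩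
          3 * (9 * n * bigNbrs y) + 27 * n * smallNbrs y    <⟨ +-mono-<-≤ (*-monoʳ-< 3 (poor⇒ refl)) (*-monoʳ-≤ (27 * n) (smallNbrs≤nSmall y)) ⟩
          3 * δ + 27 * n * nSmall                           ≤⟨ few-small ⟩
          9 * n * n                                         ≤⟨ *-monoʳ-≤ (9 * n) (big⇒ refl) ⟩
          9 * n * (3 * deg G y)                             ≡⟨ regroup n (deg G y) ⟩
          27 * n * deg G y                                  ∎))
          where
          open ≤-Reasoning
          expand : ∀ u v w → 27 * u * (v + w) ≡ 3 * (9 * u * v) + 27 * u * w
          expand = solve-∀
          regroup : ∀ u v → 9 * u * (3 * v) ≡ 27 * u * v
          regroup = solve-∀


module Certificate where

  open import Data.Nat as ℕ using (z≤n; s≤s)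
  open import Data.Integer
  open import Data.Integer.Properties
  open import Data.Integer.Tactic.RingSolver using (solve-∀)
  open import Data.Empty using (⊥; ⊥-elim)
  open import Relation.Binary.PropositionalEquality
  open import Relation.Nullary using (yes; no)

  -- Nonnegativity certificates: a polynomial is shown to be ≥ 0 by writing it
  -- (or a positive multiple of it) as a sum of products of known nonnegatives.
  Nonneg : ℤ → Set
  Nonneg x = 0ℤ ≤ x

  infixl 6 _⊕_
  infixl 7 _⊗_

  _⊕_ : ∀ {x y} → Nonneg x → Nonneg y → Nonneg (x + y)
  _⊕_ = +-mono-≤

  _⊗_ : ∀ {x y} → Nonneg x → Nonneg y → Nonneg (x * y)
  _⊗_ {+ a} {+ b} _ _ = subst Nonneg (pos-* a b) (+≤+ z≤n)

  nonneg-ℕ : ∀ m → Nonneg (+ m)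
  nonneg-ℕ m = +≤+ z≤n

  nonneg-sq : ∀ x → Nonneg (x * x)
  nonneg-sq (+ a)    = nonneg-ℕ a ⊗ nonneg-ℕ a
  nonneg-sq -[1+ a ] = +≤+ z≤n

  nonneg-≡ : ∀ {x y} → x ≡ y → Nonneg y → Nonneg x
  nonneg-≡ refl h = h

  nonneg-cancel : ∀ {c x} → 0ℤ < c → Nonneg (c * x) → Nonneg x
  nonneg-cancel {+[1+ m ]} {x} (+<+ _) h =
    *-cancelˡ-≤-pos 0ℤ x +[1+ m ] (subst (_≤ +[1+ m ] * x) (sym (*-zeroʳ +[1+ m ])) h)

  positive-* : ∀ {x y} → 0ℤ < x → 0ℤ < y → 0ℤ < x * y
  positive-* {+[1+ a ]} {+[1+ b ]} _        _        = +<+ (s≤s z≤n)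
  positive-* {+ ℕ.zero}            (+<+ ())
  positive-* {+[1+ a ]} {+ ℕ.zero} _        (+<+ ())

  positive-cube : ∀ {n} → 0ℤ < n → 0ℤ < n * n * n
  positive-cube n>0 = positive-* (positive-* n>0 n>0) n>0

  negative⇒¬nonneg : ∀ {y} → 0ℤ < - y → Nonneg y → ⊥
  negative⇒¬nonneg -y>0 y≥0 = <-irrefl refl (<-≤-trans -y>0 (neg-mono-≤ y≥0))

  -- The three polynomials of the argument, in the variables n (vertices), b (big
  -- vertices), k (poor vertices) and d (= δ).
  --   caseSlack  ≥ 0  expresses the case 9n² < 3δ + 27n(n − b) (divided by 3);
  --   edgeSlack  ≥ 0  is what the edge-density hypothesis leaves after
  --                   eliminating the pair counts;
  --   target     ≥ 0  is the inequality actually needed.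
  caseSlack : ℤ → ℤ → ℤ → ℤ
  caseSlack n b d = + 6 * n * n - + 9 * n * b + d

  edgeSlack : ℤ → ℤ → ℤ → ℤ → ℤ
  edgeSlack n b k d = + 6 * n * n * b - + 2 * n * n * n - n * d - + 9 * n * b * k + + 2 * k * d

  target : ℤ → ℤ → ℤ → ℤ → ℤ
  target n b k d = + 18 * b * n * n + + 7 * n * d - + 27 * n * b * b + + 108 * n * b * k
                   - + 27 * n * k * k - + 12 * k * d - + 54 * n * n * k

  target-at-0 : ∀ n d → target n (+ 0) (+ 0) d ≡ + 7 * n * d
  target-at-0 = expanded
    where
    expanded : ∀ n d → + 18 * + 0 * n * n + + 7 * n * d - + 27 * n * + 0 * + 0 + + 108 * n * + 0 * + 0
                       - + 27 * n * + 0 * + 0 - + 12 * + 0 * d - + 54 * n * n * + 0 ≡ + 7 * n * d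
    expanded = solve-∀

  -- The edge slack is affine in k, with slope 2δ − 9nb.
  edgeSlack-affine : ∀ n b k d → edgeSlack n b b d ≡ edgeSlack n b k d + (b - k) * (+ 2 * d - + 9 * n * b)
  edgeSlack-affine = expanded
    where
    expanded : ∀ n b k d →
      + 6 * n * n * b - + 2 * n * n * n - n * d - + 9 * n * b * b + + 2 * b * d ≡
      (+ 6 * n * n * b - + 2 * n * n * n - n * d - + 9 * n * b * k + + 2 * k * d) + (b - k) * (+ 2 * d - + 9 * n * b)
    expanded = solve-∀

  -- At k = b the edge slack is negative whenever 0 ≤ δ ≤ 4n²: two sums-of-squares
  -- representations, valid for n ≥ 2b and for n ≤ 2b respectively.
  edgeSlack-diagonal-n≥2b : ∀ n b d → - edgeSlack n b b d ≡ n * ((+ 3 * b - n) * (+ 3 * b - n)) + n * n * n + d * (n - + 2 * b)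
  edgeSlack-diagonal-n≥2b = expanded
    where
    expanded : ∀ n b d → - (+ 6 * n * n * b - + 2 * n * n * n - n * d - + 9 * n * b * b + + 2 * b * d) ≡
                         n * ((+ 3 * b - n) * (+ 3 * b - n)) + n * n * n + d * (n - + 2 * b)
    expanded = solve-∀

  edgeSlack-diagonal-n≤2b : ∀ n b d → - (+ 9 * edgeSlack n b b d) ≡
    n * ((+ 9 * b - + 7 * n) * (+ 9 * b - + 7 * n)) + + 5 * (n * n * n) + + 9 * ((+ 2 * b - n) * (+ 4 * n * n - d))
  edgeSlack-diagonal-n≤2b = expanded
    where
    expanded : ∀ n b d → - (+ 9 * (+ 6 * n * n * b - + 2 * n * n * n - n * d - + 9 * n * b * b + + 2 * b * d)) ≡
      n * ((+ 9 * b - + 7 * n) * (+ 9 * b - + 7 * n)) + + 5 * (n * n * n) + + 9 * ((+ 2 * b - n) * (+ 4 * n * n - d))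
    expanded = solve-∀

  edgeSlack-diagonal-negative : ∀ n b d → 0ℤ < n → Nonneg d → Nonneg (+ 4 * n * n - d) →
    Nonneg (edgeSlack n b b d) → ⊥
  edgeSlack-diagonal-negative n b d n>0 d≥0 d≤4n² slack≥0 with 0ℤ ≤? n - + 2 * b
  ... | yes n≥2b = negative⇒¬nonneg
    (subst (0ℤ <_) (sym (edgeSlack-diagonal-n≥2b n b d))
       (+-mono-<-≤ (+-mono-≤-< (<⇒≤ n>0 ⊗ nonneg-sq (+ 3 * b - n)) (positive-cube n>0))
                   (d≥0 ⊗ n≥2b)))
    slack≥0
  ... | no n≱2b = negative⇒¬nonneg
    (subst (0ℤ <_) (sym (edgeSlack-diagonal-n≤2b n b d))
       (+-mono-<-≤ (+-mono-≤-< (<⇒≤ n>0 ⊗ nonneg-sq (+ 9 * b - + 7 * n))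
                               (positive-* {+ 5} (+<+ (s≤s z≤n)) (positive-cube n>0)))
                   (nonneg-ℕ 9 ⊗ (2b≥n ⊗ d≤4n²))))
    (nonneg-ℕ 9 ⊗ slack≥0)
    where
    2b≥n : Nonneg (+ 2 * b - n)
    2b≥n = nonneg-≡ (sym (negate-diff n b)) (i≤j⇒0≤j-i (<⇒≤ (≰⇒> n≱2b)))
      where
      negate-diff : ∀ n b → 0ℤ - (n - + 2 * b) ≡ + 2 * b - n
      negate-diff = solve-∀

  -- Hence a nonnegative edge slack forces 2δ < 9nb, since the slope of the
  -- affine function k ↦ edgeSlack must be negative.
  slope-negative : ∀ n b k d → 0ℤ < n → Nonneg (b - k) → Nonneg d → Nonneg (+ 4 * n * n - d) →
    Nonneg (edgeSlack n b k d) → 0ℤ < + 9 * n * b - + 2 * d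
  slope-negative n b k d n>0 j≥0 d≥0 d≤4n² slack≥0 with 0ℤ <? + 9 * n * b - + 2 * d
  ... | yes slope<0 = slope<0
  ... | no slope≮0  = ⊥-elim (edgeSlack-diagonal-negative n b d n>0 d≥0 d≤4n²
          (nonneg-≡ (edgeSlack-affine n b k d) (slack≥0 ⊕ j≥0 ⊗ slope≥0)))
    where
    slope≥0 : Nonneg (+ 2 * d - + 9 * n * b)
    slope≥0 = nonneg-≡ (sym (negate-diff n b d)) (i≤j⇒0≤j-i (≮⇒≥ slope≮0))
      where
      negate-diff : ∀ n b d → 0ℤ - (+ 9 * n * b - + 2 * d) ≡ + 2 * d - + 9 * n * b
      negate-diff = solve-∀

  poor≤n/3 : ∀ n b k d → 0ℤ < n → Nonneg (b - k) → Nonneg d → Nonneg (+ 4 * n * n - d) →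
    Nonneg (caseSlack n b d) → Nonneg (edgeSlack n b k d) → Nonneg (n - + 3 * k)
  poor≤n/3 n b k d n>0 j≥0 d≥0 d≤4n² case≥0 slack≥0 =
    nonneg-cancel (slope-negative n b k d n>0 j≥0 d≥0 d≤4n² slack≥0)
      (nonneg-≡ (factor n b k d) (nonneg-ℕ 3 ⊗ slack≥0 ⊕ <⇒≤ n>0 ⊗ case≥0))
    where
    factor : ∀ n b k d → (+ 9 * n * b - + 2 * d) * (n - + 3 * k) ≡
      + 3 * (+ 6 * n * n * b - + 2 * n * n * n - n * d - + 9 * n * b * k + + 2 * k * d) + n * (+ 6 * n * n - + 9 * n * b + d)
    factor = solve-∀

  -- The main certificate: 135·n²b·target is a sum of fourteen products of the
  -- nonnegative quantities n, k, d, b − k, n − b, 4n² − d, n − 3k, caseSlack,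
  -- edgeSlack and (3b − n)².
  target-certificate : ∀ n b k d →
    + 135 * (n * n * b * target n b k d) ≡
        + 90 * n * caseSlack n b d * edgeSlack n b k d
      + + 405 * n * n * edgeSlack n b k d * k
      + + 27 * n * edgeSlack n b k d * d
      + + 126 * n * n * n * (b - k) * d
      + + 37 * n * n * d * d
      + + 114 * n * n * n * d * (n - + 3 * k)
      + + 5 * caseSlack n b d * caseSlack n b d * caseSlack n b d
      + + 90 * n * caseSlack n b d * (b - k) * d
      + + 5 * caseSlack n b d * d * (+ 4 * n * n - d)
      + + 324 * n * n * k * d * (n - + 3 * k)
      + + 144 * n * k * d * (+ 4 * n * n - d)
      + + 162 * n * n * (b - k) * (b - k) * d
      + + 567 * n * n * (b - k) * d * (n - b)
      + + 810 * n * n * n * ((+ 3 * b - n) * (+ 3 * b - n)) * k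
  target-certificate = expanded
    where
    expanded : ∀ (n b k d : ℤ) →
      + 135 * (n * n * b * (+ 18 * b * n * n + + 7 * n * d - + 27 * n * b * b + + 108 * n * b * k - + 27 * n * k * k - + 12 * k * d - + 54 * n * n * k)) ≡
          + 90 * n * (+ 6 * n * n - + 9 * n * b + d) * (+ 6 * n * n * b - + 2 * n * n * n - n * d - + 9 * n * b * k + + 2 * k * d)
          + + 405 * n * n * (+ 6 * n * n * b - + 2 * n * n * n - n * d - + 9 * n * b * k + + 2 * k * d) * k
          + + 27 * n * (+ 6 * n * n * b - + 2 * n * n * n - n * d - + 9 * n * b * k + + 2 * k * d) * d
          + + 126 * n * n * n * (b - k) * d
          + + 37 * n * n * d * d + + 114 * n * n * n * d * (n - + 3 * k)
          + + 5 * (+ 6 * n * n - + 9 * n * b + d) * (+ 6 * n * n - + 9 * n * b + d) * (+ 6 * n * n - + 9 * n * b + d)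
          + + 90 * n * (+ 6 * n * n - + 9 * n * b + d) * (b - k) * d
          + + 5 * (+ 6 * n * n - + 9 * n * b + d) * d * (+ 4 * n * n - d)
          + + 324 * n * n * k * d * (n - + 3 * k) + + 144 * n * k * d * (+ 4 * n * n - d)
          + + 162 * n * n * (b - k) * (b - k) * d
          + + 567 * n * n * (b - k) * d * (n - b) + + 810 * n * n * n * ((+ 3 * b - n) * (+ 3 * b - n)) * k
    expanded = solve-∀

  target-nonneg : ∀ n b k d → 0ℤ < n → Nonneg k → Nonneg (b - k) → Nonneg (n - b) → Nonneg d →
    Nonneg (+ 4 * n * n - d) → Nonneg (caseSlack n b d) → Nonneg (edgeSlack n b k d) → Nonneg (target n b k d)
  target-nonneg n b k d n>0 k≥0 j≥0 ℓ≥0 d≥0 d≤4n² case≥0 slack≥0 with 0ℤ <? b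
  ... | no b≯0 = subst₂ (λ b′ k′ → Nonneg (target n b′ k′ d)) (sym b≡0) (sym k≡0)
                   (nonneg-≡ (target-at-0 n d) (nonneg-ℕ 7 ⊗ <⇒≤ n>0 ⊗ d≥0))
    where
    b≤0 : b ≤ 0ℤ
    b≤0 = ≮⇒≥ b≯0
    k≤b : k ≤ b
    k≤b = 0≤i-j⇒j≤i j≥0
    b≡0 : b ≡ + 0
    b≡0 = ≤-antisym b≤0 (≤-trans k≥0 k≤b)
    k≡0 : k ≡ + 0
    k≡0 = ≤-antisym (≤-trans k≤b b≤0) k≥0
  ... | yes b>0 = nonneg-cancel 135n²b>0 (nonneg-≡ (*-assoc (+ 135) (n * n * b) (target n b k d))
                    (nonneg-≡ (target-certificate n b k d) (
         nonneg-ℕ 90 ⊗ n≥0 ⊗ case≥0 ⊗ slack≥0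
       ⊕ nonneg-ℕ 405 ⊗ n≥0 ⊗ n≥0 ⊗ slack≥0 ⊗ k≥0
       ⊕ nonneg-ℕ 27 ⊗ n≥0 ⊗ slack≥0 ⊗ d≥0
       ⊕ nonneg-ℕ 126 ⊗ n≥0 ⊗ n≥0 ⊗ n≥0 ⊗ j≥0 ⊗ d≥0
       ⊕ nonneg-ℕ 37 ⊗ n≥0 ⊗ n≥0 ⊗ d≥0 ⊗ d≥0
       ⊕ nonneg-ℕ 114 ⊗ n≥0 ⊗ n≥0 ⊗ n≥0 ⊗ d≥0 ⊗ n≥3k
       ⊕ nonneg-ℕ 5 ⊗ case≥0 ⊗ case≥0 ⊗ case≥0
       ⊕ nonneg-ℕ 90 ⊗ n≥0 ⊗ case≥0 ⊗ j≥0 ⊗ d≥0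
       ⊕ nonneg-ℕ 5 ⊗ case≥0 ⊗ d≥0 ⊗ d≤4n²
       ⊕ nonneg-ℕ 324 ⊗ n≥0 ⊗ n≥0 ⊗ k≥0 ⊗ d≥0 ⊗ n≥3k
       ⊕ nonneg-ℕ 144 ⊗ n≥0 ⊗ k≥0 ⊗ d≥0 ⊗ d≤4n²
       ⊕ nonneg-ℕ 162 ⊗ n≥0 ⊗ n≥0 ⊗ j≥0 ⊗ j≥0 ⊗ d≥0
       ⊕ nonneg-ℕ 567 ⊗ n≥0 ⊗ n≥0 ⊗ j≥0 ⊗ d≥0 ⊗ ℓ≥0
       ⊕ nonneg-ℕ 810 ⊗ n≥0 ⊗ n≥0 ⊗ n≥0 ⊗ nonneg-sq (+ 3 * b - n) ⊗ k≥0)))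
    where
    n≥0 : Nonneg n
    n≥0 = <⇒≤ n>0
    135n²b>0 : 0ℤ < + 135 * (n * n * b)
    135n²b>0 = positive-* {+ 135} (+<+ (s≤s z≤n)) (positive-* (positive-* n>0 n>0) b>0)
    n≥3k : Nonneg (n - + 3 * k)
    n≥3k = poor≤n/3 n b k d n>0 j≥0 d≥0 d≤4n² case≥0 slack≥0

  -- The key inequality, in the variables of the counting argument: n vertices,
  -- b big and k poor ones, d = δ, and the pair counts p (small–small),
  -- e (small–big), x (poor–big), s (poor–small).
  key-inequality : ∀ n b k d p e x s → 0ℤ < n → 0ℤ ≤ k → k ≤ b → b ≤ n → 0ℤ ≤ d →
    + 5 * n * n + d ≤ + 9 * p + + 18 * e + + 9 * ((b - k) * (b - k)) + + 18 * x →
    + 3 * (p + e) ≤ (n - b) * n → s ≤ k * (n - b) → + 9 * n * x ≤ k * d → e ≤ (n - b) * b →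
    d ≤ + 4 * n * n → + 9 * n * n ≤ + 3 * d + + 27 * n * (n - b) →
    + 27 * p + + 54 * x + + 54 * s ≤ + 3 * n * n + + 4 * d
  key-inequality n b k d p e x s n>0 k≥0 k≤b b≤n d≥0 edges small-deg poor-small poor-big small-big d≤4n² few-small =
    0≤i-j⇒j≤i (nonneg-cancel n>0 (nonneg-≡ (key-identity n b k d p e x s)
      (n≥0 ⊗ (nonneg-ℕ 3 ⊗ (nonneg-ℕ 6 ⊗ gap small-deg ⊕ gap edges))
       ⊕ nonneg-ℕ 54 ⊗ n≥0 ⊗ gap poor-small
       ⊕ target-nonneg n b k d n>0 k≥0 j≥0 ℓ≥0 d≥0 (gap d≤4n²) case≥0 slack≥0
       ⊕ nonneg-ℕ 12 ⊗ gap poor-big)))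
    where
    gap : ∀ {u v} → u ≤ v → Nonneg (v - u)
    gap = i≤j⇒0≤j-i
    n≥0 : Nonneg n
    n≥0 = <⇒≤ n>0
    j≥0 : Nonneg (b - k)
    j≥0 = gap k≤b
    ℓ≥0 : Nonneg (n - b)
    ℓ≥0 = gap b≤n
    case≥0 : Nonneg (caseSlack n b d)
    case≥0 = nonneg-cancel {+ 3} (+<+ (s≤s z≤n)) (nonneg-≡ (sym (case-identity n b d)) (gap few-small))
      where
      case-identity : ∀ n b d → + 3 * d + + 27 * n * (n - b) - + 9 * n * n ≡ + 3 * (+ 6 * n * n - + 9 * n * b + d)
      case-identity = solve-∀
    slack≥0 : Nonneg (edgeSlack n b k d)
    slack≥0 = nonneg-≡ (slack-identity n b k d p e x)
      (n≥0 ⊗ (gap edges ⊕ nonneg-ℕ 3 ⊗ gap small-deg ⊕ nonneg-ℕ 9 ⊗ gap small-big)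
       ⊕ nonneg-ℕ 2 ⊗ gap poor-big ⊕ nonneg-ℕ 9 ⊗ n≥0 ⊗ k≥0 ⊗ j≥0)
      where
      slack-identity : ∀ n b k d p e x →
        + 6 * n * n * b - + 2 * n * n * n - n * d - + 9 * n * b * k + + 2 * k * d ≡
          n * ((+ 9 * p + + 18 * e + + 9 * ((b - k) * (b - k)) + + 18 * x - (+ 5 * n * n + d))
               + + 3 * ((n - b) * n - + 3 * (p + e)) + + 9 * ((n - b) * b - e))
          + + 2 * (k * d - + 9 * n * x) + + 9 * n * k * (b - k)
      slack-identity = solve-∀
    key-identity : ∀ n b k d p e x s →
      n * (+ 3 * n * n + + 4 * d - (+ 27 * p + + 54 * x + + 54 * s)) ≡
        n * (+ 3 * (+ 6 * ((n - b) * n - + 3 * (p + e))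
                    + (+ 9 * p + + 18 * e + + 9 * ((b - k) * (b - k)) + + 18 * x - (+ 5 * n * n + d))))
        + + 54 * n * (k * (n - b) - s)
        + (+ 18 * b * n * n + + 7 * n * d - + 27 * n * b * b + + 108 * n * b * k
           - + 27 * n * k * k - + 12 * k * d - + 54 * n * n * k)
        + + 12 * (k * d - + 9 * n * x)
    key-identity = solve-∀


module IntegerCast where

  open import Data.Nat as ℕ using (ℕ)
  open import Data.Integer
  open import Data.Integer.Properties using (pos-+; pos-*; drop‿+≤+)
  open import Data.Integer.Tactic.RingSolver using (solve-∀)
  open import Relation.Binary.PropositionalEquality

  -- Casting a natural-number polynomial to ℤ, following its syntax tree: each
  -- leaf is an equation + a ≡ a′ (usually refl), and the combinators use
  -- that +_ is a semiring homomorphism.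
  infixl 6 _⟨+⟩_
  infixl 7 _⟨*⟩_

  _⟨+⟩_ : ∀ {a b a′ b′} → + a ≡ a′ → + b ≡ b′ → + (a ℕ.+ b) ≡ a′ + b′
  _⟨+⟩_ {a} {b} p q = trans (pos-+ a b) (cong₂ _+_ p q)

  _⟨*⟩_ : ∀ {a b a′ b′} → + a ≡ a′ → + b ≡ b′ → + (a ℕ.* b) ≡ a′ * b′
  _⟨*⟩_ {a} {b} p q = trans (pos-* a b) (cong₂ _*_ p q)

  ⟨_⟩ : ∀ a → + a ≡ + a
  ⟨ a ⟩ = refl

  cast-≤ : ∀ {a b a′ b′} → + a ≡ a′ → + b ≡ b′ → a ℕ.≤ b → a′ ≤ b′
  cast-≤ refl refl a≤b = +≤+ a≤b

  uncast-≤ : ∀ {a b a′ b′} → + a ≡ a′ → + b ≡ b′ → a′ ≤ b′ → a ℕ.≤ b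
  uncast-≤ refl refl = drop‿+≤+

  cast-difference : ∀ {a b c} → a ℕ.+ b ≡ c → + a ≡ + c - + b
  cast-difference {a} {b} refl = trans (add-sub (+ a) (+ b)) (cong (_- + b) (sym (pos-+ a b)))
    where
    add-sub : ∀ x y → x ≡ x + y - y
    add-sub = solve-∀


module KeyInequality where

  open import Data.Nat as ℕ using (ℕ)
  open import Data.Nat.Properties using (m≤n+m)
  open import Data.Integer
  open import Relation.Binary.PropositionalEquality
  open Certificate using (key-inequality)
  open IntegerCast

  -- The key inequality for natural numbers, with ℓ = n − b small and j = b − k
  -- rich vertices.
  key-inequality-ℕ : ∀ (n ℓ b k j δ p e x s : ℕ) → 0 ℕ.< n → ℓ ℕ.+ b ≡ n → j ℕ.+ k ≡ b →
    5 ℕ.* n ℕ.* n ℕ.+ δ ℕ.≤ 9 ℕ.* p ℕ.+ 18 ℕ.* e ℕ.+ 9 ℕ.* (j ℕ.* j) ℕ.+ 18 ℕ.* x →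
    3 ℕ.* (p ℕ.+ e) ℕ.≤ ℓ ℕ.* n → s ℕ.≤ k ℕ.* ℓ → 9 ℕ.* n ℕ.* x ℕ.≤ k ℕ.* δ → e ℕ.≤ ℓ ℕ.* b →
    δ ℕ.≤ 4 ℕ.* n ℕ.* n → 9 ℕ.* n ℕ.* n ℕ.≤ 3 ℕ.* δ ℕ.+ 27 ℕ.* n ℕ.* ℓ →
    27 ℕ.* p ℕ.+ 54 ℕ.* x ℕ.+ 54 ℕ.* s ℕ.≤ 3 ℕ.* n ℕ.* n ℕ.+ 4 ℕ.* δ
  key-inequality-ℕ n ℓ b k j δ p e x s n>0 ℓ+b≡n j+k≡b edges small-deg poor-small poor-big small-big δ≤4n² few-small =
    uncast-≤ (⟨ 27 ⟩ ⟨*⟩ ⟨ p ⟩ ⟨+⟩ ⟨ 54 ⟩ ⟨*⟩ ⟨ x ⟩ ⟨+⟩ ⟨ 54 ⟩ ⟨*⟩ ⟨ s ⟩)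
             (⟨ 3 ⟩ ⟨*⟩ ⟨ n ⟩ ⟨*⟩ ⟨ n ⟩ ⟨+⟩ ⟨ 4 ⟩ ⟨*⟩ ⟨ δ ⟩)
      (key-inequality (+ n) (+ b) (+ k) (+ δ) (+ p) (+ e) (+ x) (+ s) (+<+ n>0) (+≤+ ℕ.z≤n)
        (+≤+ (subst (k ℕ.≤_) j+k≡b (m≤n+m k j))) (+≤+ (subst (b ℕ.≤_) ℓ+b≡n (m≤n+m b ℓ))) (+≤+ ℕ.z≤n)
        (cast-≤ (⟨ 5 ⟩ ⟨*⟩ ⟨ n ⟩ ⟨*⟩ ⟨ n ⟩ ⟨+⟩ ⟨ δ ⟩)
                (⟨ 9 ⟩ ⟨*⟩ ⟨ p ⟩ ⟨+⟩ ⟨ 18 ⟩ ⟨*⟩ ⟨ e ⟩ ⟨+⟩ ⟨ 9 ⟩ ⟨*⟩ (j≡ ⟨*⟩ j≡) ⟨+⟩ ⟨ 18 ⟩ ⟨*⟩ ⟨ x ⟩) edges)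
        (cast-≤ (⟨ 3 ⟩ ⟨*⟩ (⟨ p ⟩ ⟨+⟩ ⟨ e ⟩)) (ℓ≡ ⟨*⟩ ⟨ n ⟩) small-deg)
        (cast-≤ ⟨ s ⟩ (⟨ k ⟩ ⟨*⟩ ℓ≡) poor-small)
        (cast-≤ (⟨ 9 ⟩ ⟨*⟩ ⟨ n ⟩ ⟨*⟩ ⟨ x ⟩) (⟨ k ⟩ ⟨*⟩ ⟨ δ ⟩) poor-big)
        (cast-≤ ⟨ e ⟩ (ℓ≡ ⟨*⟩ ⟨ b ⟩) small-big)
        (cast-≤ ⟨ δ ⟩ (⟨ 4 ⟩ ⟨*⟩ ⟨ n ⟩ ⟨*⟩ ⟨ n ⟩) δ≤4n²)
        (cast-≤ (⟨ 9 ⟩ ⟨*⟩ ⟨ n ⟩ ⟨*⟩ ⟨ n ⟩) (⟨ 3 ⟩ ⟨*⟩ ⟨ δ ⟩ ⟨+⟩ ⟨ 27 ⟩ ⟨*⟩ ⟨ n ⟩ ⟨*⟩ ℓ≡) few-small))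
    where
    ℓ≡ : + ℓ ≡ + n - + b
    ℓ≡ = cast-difference ℓ+b≡n
    j≡ : + j ≡ + b - + k
    j≡ = cast-difference j+k≡b


module CountingBound where

  open import Defs using (Graph; deg; edges; goodTriples)
  open FiniteSum using (module OverFin)
  open Handshake using (handshake; degree-sum≤n²)
  open VertexClasses using (module VertexSplit)
  open KeyInequality using (key-inequality-ℕ)
  open import Data.Nat
  open import Data.Nat.Properties
  open import Data.Nat.Tactic.RingSolver using (solve-∀)
  open import Relation.Binary.PropositionalEquality
  open import Data.Sum using ([_,_]′)

  module Bound {n : ℕ} (G G' : Graph n) (m δ : ℕ) (m≤e : m ≤ edges G) (m≤e' : m ≤ edges G')
               (18m≡ : 18 * m ≡ 5 * n * n + δ) (n>0 : 0 < n) where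
    open OverFin n
    open VertexSplit G G' δ

    degree-sum-lower : 5 * n * n + δ ≤ 9 * Σ (deg G)
    degree-sum-lower = begin
      5 * n * n + δ         ≡⟨ sym 18m≡ ⟩
      18 * m                ≡⟨ *-assoc 9 2 m ⟩
      9 * (2 * m)           ≤⟨ *-monoʳ-≤ 9 (≤-trans (*-monoʳ-≤ 2 m≤e) (handshake G)) ⟩
      9 * Σ (deg G)         ∎
      where open ≤-Reasoning

    δ≤4n² : δ ≤ 4 * n * n
    δ≤4n² = +-cancelˡ-≤ (5 * n * n) δ (4 * n * n) (begin
      5 * n * n + δ         ≤⟨ degree-sum-lower ⟩
      9 * Σ (deg G)         ≤⟨ *-monoʳ-≤ 9 (degree-sum≤n² G) ⟩
      9 * (n * n)           ≡⟨ split n ⟩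
      5 * n * n + 4 * n * n ∎)
      where
      open ≤-Reasoning
      split : ∀ n → 9 * (n * n) ≡ 5 * n * n + 4 * n * n
      split = solve-∀

    edges-by-pairs : 5 * n * n + δ ≤ 9 * pairsSS + 18 * pairsSB + 9 * (nRich * nRich) + 18 * pairsPB
    edges-by-pairs = begin
      5 * n * n + δ                     ≤⟨ degree-sum-lower ⟩
      9 * Σ (deg G)                     ≤⟨ *-monoʳ-≤ 9 degree-sum-bound ⟩
      9 * (p + e + (j * j + x + x) + e) ≡⟨ expand p e j x ⟩
      9 * p + 18 * e + 9 * (j * j) + 18 * x ∎
      where
      open ≤-Reasoning
      p e j x : ℕ
      p = pairsSS ; e = pairsSB ; j = nRich ; x = pairsPB
      expand : ∀ p e j x → 9 * (p + e + (j * j + x + x) + e) ≡ 9 * p + 18 * e + 9 * (j * j) + 18 * x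
      expand = solve-∀

    -- The pair counts involving poor vertices are controlled: by the key
    -- inequality when many vertices are small, and because there are no poor
    -- vertices otherwise.
    pairs-bound : 27 * pairsSS + 54 * pairsPB + 54 * pairsPS ≤ 3 * n * n + 4 * δ
    pairs-bound = [ many-small , few-small ]′ (≤-total (9 * n * n) (3 * δ + 27 * n * nSmall))
      where
      many-small : 9 * n * n ≤ 3 * δ + 27 * n * nSmall → 27 * pairsSS + 54 * pairsPB + 54 * pairsPS ≤ 3 * n * n + 4 * δ
      many-small =
        key-inequality-ℕ n nSmall nBig nPoor nRich δ pairsSS pairsSB pairsPB pairsPS n>0
          nSmall+nBig nRich+nPoor edges-by-pairs small-degrees pairsPS-bound pairsPB-bound pairsSB-bound δ≤4n²
      few-small : 3 * δ + 27 * n * nSmall ≤ 9 * n * n → 27 * pairsSS + 54 * pairsPB + 54 * pairsPS ≤ 3 * n * n + 4 * δ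
      few-small few = begin
        27 * pairsSS + 54 * pairsPB + 54 * pairsPS ≡⟨ cong₂ (λ x s → 27 * pairsSS + 54 * x + 54 * s) pairsPB≡0 pairsPS≡0 ⟩
        27 * pairsSS + 54 * 0 + 54 * 0             ≡⟨ simplify pairsSS ⟩
        9 * (3 * pairsSS)                          ≤⟨ *-monoʳ-≤ 9 (≤-trans (*-monoʳ-≤ 3 (m≤m+n pairsSS pairsSB)) small-degrees) ⟩
        9 * (nSmall * n)                           ≤⟨ *-cancelˡ-≤ 3 (begin
            3 * (9 * (nSmall * n))                   ≡⟨ regroup nSmall n ⟩
            27 * n * nSmall                          ≤⟨ m≤n+m (27 * n * nSmall) (3 * δ) ⟩
            3 * δ + 27 * n * nSmall                  ≤⟨ few ⟩
            9 * n * n                                ≡⟨ thirds n ⟩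
            3 * (3 * n * n)                          ∎) ⟩
        3 * n * n                                  ≤⟨ m≤m+n (3 * n * n) (4 * δ) ⟩
        3 * n * n + 4 * δ                          ∎
        where
        open ≤-Reasoning
        nPoor≡0 : nPoor ≡ 0
        nPoor≡0 = no-poor few
        pairsPB≡0 : pairsPB ≡ 0
        pairsPB≡0 = n≤0⇒n≡0 (*-cancelˡ-≤ (9 * n) {{>-nonZero (*-monoʳ-< 9 n>0)}}
                      (≤-trans pairsPB-bound (≤-reflexive (trans (cong (_* δ) nPoor≡0) (sym (*-zeroʳ (9 * n)))))))
        pairsPS≡0 : pairsPS ≡ 0
        pairsPS≡0 = n≤0⇒n≡0 (≤-trans pairsPS-bound (≤-reflexive (cong (_* nSmall) nPoor≡0)))
        simplify : ∀ p → 27 * p + 54 * 0 + 54 * 0 ≡ 9 * (3 * p)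
        simplify = solve-∀
        regroup : ∀ l n → 3 * (9 * (l * n)) ≡ 27 * n * l
        regroup = solve-∀
        thirds : ∀ n → 9 * n * n ≡ 3 * (3 * n * n)
        thirds = solve-∀

    edges-both : 2 * edges G + 2 * edges G' ≤ 2 * commonRich + 2 * pairsPB + 2 * pairsPS + pairsSS + n * n
    edges-both = begin
      2 * edges G + 2 * edges G'               ≤⟨ +-mono-≤ (handshake G) (handshake G') ⟩
      Σ (deg G) + Σ (deg G')                   ≤⟨ union-bound ⟩
      Σ common + n * n                         ≤⟨ +-monoˡ-≤ (n * n) common-bound ⟩
      A + A + p + n * n                        ≤⟨ +-monoˡ-≤ (n * n) (+-monoˡ-≤ p (+-mono-≤ commonBig-bound commonBig-bound)) ⟩
      S + x + s + (S + x + s) + p + n * n      ≡⟨ collect S x s p (n * n) ⟩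
      2 * S + 2 * x + 2 * s + p + n * n        ∎
      where
      open ≤-Reasoning
      A S x s p : ℕ
      A = commonBig ; S = commonRich ; x = pairsPB ; s = pairsPS ; p = pairsSS
      collect : ∀ S x s p q → S + x + s + (S + x + s) + p + q ≡ 2 * S + 2 * x + 2 * s + p + q
      collect = solve-∀

    δ≤27·commonRich : δ ≤ 27 * commonRich
    δ≤27·commonRich = *-cancelˡ-≤ 2 (≤-trans (+-cancelˡ-≤ (30 * (n * n) + 4 * δ) (2 * δ) (54 * S) (begin
      30 * (n * n) + 4 * δ + 2 * δ                   ≡⟨ six-times δ n ⟩
      6 * (5 * n * n + δ)                            ≡⟨ cong (6 *_) (sym 18m≡) ⟩
      6 * (18 * m)                                   ≡⟨ four-m m ⟩
      27 * (2 * m + 2 * m)                           ≤⟨ *-monoʳ-≤ 27 (+-mono-≤ (*-monoʳ-≤ 2 m≤e) (*-monoʳ-≤ 2 m≤e')) ⟩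
      27 * (2 * edges G + 2 * edges G')              ≤⟨ *-monoʳ-≤ 27 edges-both ⟩
      27 * (2 * S + 2 * x + 2 * s + p + n * n)       ≡⟨ distribute S x s p (n * n) ⟩
      54 * S + (27 * p + 54 * x + 54 * s) + 27 * (n * n) ≤⟨ +-monoˡ-≤ (27 * (n * n)) (+-monoʳ-≤ (54 * S) pairs-bound) ⟩
      54 * S + (3 * n * n + 4 * δ) + 27 * (n * n)    ≡⟨ collect S n δ ⟩
      30 * (n * n) + 4 * δ + 54 * S                  ∎)) (≤-reflexive (*-assoc 2 27 S)))
      where
      open ≤-Reasoning
      S x s p : ℕ
      S = commonRich ; x = pairsPB ; s = pairsPS ; p = pairsSS
      six-times : ∀ d n → 30 * (n * n) + 4 * d + 2 * d ≡ 6 * (5 * n * n + d)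
      six-times = solve-∀
      four-m : ∀ m → 6 * (18 * m) ≡ 27 * (2 * m + 2 * m)
      four-m = solve-∀
      distribute : ∀ S x s p q → 27 * (2 * S + 2 * x + 2 * s + p + q) ≡ 54 * S + (27 * p + 54 * x + 54 * s) + 27 * q
      distribute = solve-∀
      collect : ∀ S n d → 54 * S + (3 * n * n + 4 * d) + 27 * (n * n) ≡ 30 * (n * n) + 4 * d + 54 * S
      collect = solve-∀

    counting-bound : δ * δ ≤ 243 * n * goodTriples G G'
    counting-bound = begin
      δ * δ                             ≤⟨ *-monoʳ-≤ δ δ≤27·commonRich ⟩
      δ * (27 * commonRich)             ≡⟨ regroup δ commonRich ⟩
      27 * (δ * commonRich)             ≤⟨ *-monoʳ-≤ 27 richCommon-bound ⟩
      27 * (9 * n * goodTriples G G')   ≡⟨ sym (*-assoc 27 (9 * n) _) ⟩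
      27 * (9 * n) * goodTriples G G'   ≡⟨ cong (_* goodTriples G G') (sym (*-assoc 27 9 n)) ⟩
      243 * n * goodTriples G G'        ∎
      where
      open ≤-Reasoning
      regroup : ∀ d S → d * (27 * S) ≡ 27 * (d * S)
      regroup = solve-∀


module RationalForm where

  open import Data.Nat as ℕ using (ℕ; suc)
  open import Data.Nat.Tactic.RingSolver using (solve-∀)
  open import Data.Integer using (+_)
  open import Data.Rational using (ℚ; mkℚ; _/_; _+_; _*_; _≤_; toℚᵘ)
  open import Data.Rational.Properties using (normalize-coprime; toℚᵘ-homo-+; toℚᵘ-homo-*; toℚᵘ-mono-≤; toℚᵘ-cancel-≤)
  open import Data.Rational.Unnormalised as ℚᵘ using (mkℚᵘ; *≤*)
  open import Data.Rational.Unnormalised.Properties using (≃-trans; ≃-sym; ≃-reflexive; *-cong; *-congʳ; ≤-respˡ-≃; drop-*≤*)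
  open import Data.Nat.Coprimality using (Coprime; 1-coprimeTo)
  import Data.Nat.Coprimality as Coprime
  open import Relation.Binary.PropositionalEquality
  open IntegerCast

  -- Rationals are compared through their unnormalised representatives, where
  -- numerators and denominators of sums and products are computed by the
  -- schoolbook formulas.  Below α = a/q with a = suc a′, q = suc d.

  ℕ/1 : ∀ n → toℚᵘ (+ n / 1) ≡ mkℚᵘ (+ n) 0
  ℕ/1 n = cong toℚᵘ (normalize-coprime {n} {0} (Coprime.sym (1-coprimeTo n)))

  edge-hypothesis : ∀ (a′ d : ℕ) .(c : Coprime (suc a′) (suc d)) (n E : ℕ) →
    ((+ 5 / 9) + mkℚ (+ suc a′) d c) * ((+ n / 1) * (+ n / 1)) * (+ 1 / 2) ≤ (+ E / 1) →
    (5 ℕ.* suc d ℕ.+ 9 ℕ.* suc a′) ℕ.* (n ℕ.* n) ℕ.≤ 18 ℕ.* suc d ℕ.* E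
  edge-hypothesis a′ d c n E h = uncast-≤
    (trans (cong +_ (lhs (suc d) (suc a′) n))
           ((⟨ 5 ⟩ ⟨*⟩ ⟨ suc d ⟩ ⟨+⟩ ⟨ suc a′ ⟩ ⟨*⟩ ⟨ 9 ⟩) ⟨*⟩ (⟨ n ⟩ ⟨*⟩ ⟨ n ⟩) ⟨*⟩ ⟨ 1 ⟩ ⟨*⟩ ⟨ 1 ⟩))
    (trans (cong +_ (rhs (suc d) E)) (⟨ E ⟩ ⟨*⟩ (⟨ 9 ⟩ ⟨*⟩ ⟨ suc d ⟩ ⟨*⟩ (⟨ 1 ⟩ ⟨*⟩ ⟨ 1 ⟩) ⟨*⟩ ⟨ 2 ⟩)))
    (drop-*≤* (≤-respˡ-≃ unnormalised (subst (_ ℚᵘ.≤_) (ℕ/1 E) (toℚᵘ-mono-≤ h))))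
    where
    α N : ℚ
    α = mkℚ (+ suc a′) d c
    N = + n / 1
    unnormalised : toℚᵘ ((+ 5 / 9 + α) * (N * N) * (+ 1 / 2)) ℚᵘ.≃
                   (mkℚᵘ (+ 5) 8 ℚᵘ.+ mkℚᵘ (+ suc a′) d) ℚᵘ.* (mkℚᵘ (+ n) 0 ℚᵘ.* mkℚᵘ (+ n) 0) ℚᵘ.* mkℚᵘ (+ 1) 1
    unnormalised = ≃-trans (toℚᵘ-homo-* ((+ 5 / 9 + α) * (N * N)) (+ 1 / 2))
      (*-congʳ (≃-trans (toℚᵘ-homo-* (+ 5 / 9 + α) (N * N))
        (*-cong (toℚᵘ-homo-+ (+ 5 / 9) α) (≃-trans (toℚᵘ-homo-* N N) (*-cong (≃-reflexive (ℕ/1 n)) (≃-reflexive (ℕ/1 n)))))))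
    lhs : ∀ q a n → (5 ℕ.* q ℕ.+ 9 ℕ.* a) ℕ.* (n ℕ.* n) ≡ (5 ℕ.* q ℕ.+ a ℕ.* 9) ℕ.* (n ℕ.* n) ℕ.* 1 ℕ.* 1
    lhs = solve-∀
    rhs : ∀ q E → 18 ℕ.* q ℕ.* E ≡ E ℕ.* (9 ℕ.* q ℕ.* (1 ℕ.* 1) ℕ.* 2)
    rhs = solve-∀

  triple-conclusion : ∀ (a′ d : ℕ) .(c : Coprime (suc a′) (suc d)) (n T : ℕ) →
    suc a′ ℕ.* suc a′ ℕ.* (n ℕ.* n ℕ.* n) ℕ.≤ 3 ℕ.* (suc d ℕ.* suc d) ℕ.* T →
    mkℚ (+ suc a′) d c * mkℚ (+ suc a′) d c * (+ 1 / 3) * ((+ n / 1) * (+ n / 1) * (+ n / 1)) ≤ (+ T / 1)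
  triple-conclusion a′ d c n T h = toℚᵘ-cancel-≤ (subst (_ ℚᵘ.≤_) (sym (ℕ/1 T)) (≤-respˡ-≃ (≃-sym unnormalised)
    (*≤* (cast-≤ (trans (cong +_ (lhs (suc a′) n)) ((⟨ suc a′ ⟩ ⟨*⟩ ⟨ suc a′ ⟩) ⟨*⟩ ⟨ 1 ⟩ ⟨*⟩ ((⟨ n ⟩ ⟨*⟩ ⟨ n ⟩) ⟨*⟩ ⟨ n ⟩) ⟨*⟩ ⟨ 1 ⟩))
                 (trans (cong +_ (rhs (suc d) T)) (⟨ T ⟩ ⟨*⟩ (⟨ suc d ⟩ ⟨*⟩ ⟨ suc d ⟩ ⟨*⟩ ⟨ 3 ⟩ ⟨*⟩ (⟨ 1 ⟩ ⟨*⟩ ⟨ 1 ⟩ ⟨*⟩ ⟨ 1 ⟩))))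
                 h))))
    where
    α N : ℚ
    α = mkℚ (+ suc a′) d c
    N = + n / 1
    unnormalised : toℚᵘ (α * α * (+ 1 / 3) * (N * N * N)) ℚᵘ.≃
                   (mkℚᵘ (+ suc a′) d ℚᵘ.* mkℚᵘ (+ suc a′) d) ℚᵘ.* mkℚᵘ (+ 1) 2 ℚᵘ.* ((mkℚᵘ (+ n) 0 ℚᵘ.* mkℚᵘ (+ n) 0) ℚᵘ.* mkℚᵘ (+ n) 0)
    unnormalised = ≃-trans (toℚᵘ-homo-* (α * α * (+ 1 / 3)) (N * N * N))
      (*-cong (≃-trans (toℚᵘ-homo-* (α * α) (+ 1 / 3)) (*-congʳ (toℚᵘ-homo-* α α)))
              (≃-trans (toℚᵘ-homo-* (N * N) N) (*-cong (≃-trans (toℚᵘ-homo-* N N) (*-cong (≃-reflexive (ℕ/1 n)) (≃-reflexive (ℕ/1 n)))) (≃-reflexive (ℕ/1 n)))))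
    lhs : ∀ a n → a ℕ.* a ℕ.* (n ℕ.* n ℕ.* n) ≡ a ℕ.* a ℕ.* 1 ℕ.* (n ℕ.* n ℕ.* n) ℕ.* 1
    lhs = solve-∀
    rhs : ∀ q T → 3 ℕ.* (q ℕ.* q) ℕ.* T ≡ T ℕ.* (q ℕ.* q ℕ.* 3 ℕ.* (1 ℕ.* 1 ℕ.* 1))
    rhs = solve-∀


module NaturalForm where

  open import Defs using (Graph; edges; goodTriples)
  open CountingBound using (module Bound)
  open import Data.Nat
  open import Data.Nat.Properties
  open import Data.Nat.Tactic.RingSolver using (solve-∀)
  open import Relation.Binary.PropositionalEquality

  natural-form : ∀ {n} (G G' : Graph n) (a q : ℕ) → 0 < q →
    (5 * q + 9 * a) * (n * n) ≤ 18 * q * edges G →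
    (5 * q + 9 * a) * (n * n) ≤ 18 * q * edges G' →
    a * a * (n * n * n) ≤ 3 * (q * q) * goodTriples G G'
  natural-form {zero} G G' a q _ _ _ = subst (_≤ 3 * (q * q) * goodTriples G G') (sym (*-zeroʳ (a * a))) z≤n
  natural-form {n@(suc _)} G G' a q q>0 edgesG edgesG' =
    *-cancelˡ-≤ (81 * n) (begin
      81 * n * (a * a * (n * n * n))          ≡⟨ square a n ⟩
      (9 * a * (n * n)) * (9 * a * (n * n))   ≤⟨ *-mono-≤ 9an²≤qδ 9an²≤qδ ⟩
      (q * δ) * (q * δ)                       ≡⟨ regroup q δ ⟩
      q * q * (δ * δ)                         ≤⟨ *-monoʳ-≤ (q * q) (Bound.counting-bound G G' m δ (m⊓n≤m _ _) (m⊓n≤n _ _) 18m≡ (s≤s z≤n)) ⟩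
      q * q * (243 * n * T)                   ≡⟨ factor q n T ⟩
      81 * n * (3 * (q * q) * T)              ∎)
    where
    open ≤-Reasoning
    instance
      q≢0 : NonZero q
      q≢0 = >-nonZero q>0
    T : ℕ
    T = goodTriples G G'
    m : ℕ
    m = edges G ⊓ edges G'
    hyp-min : (5 * q + 9 * a) * (n * n) ≤ q * (18 * m)
    hyp-min = ≤-trans (⊓-glb edgesG edgesG')
                      (≤-reflexive (trans (sym (*-distribˡ-⊓ (18 * q) (edges G) (edges G'))) (*-assoc-18 q m)))
      where
      *-assoc-18 : ∀ q m → 18 * q * m ≡ q * (18 * m)
      *-assoc-18 = solve-∀
    split : q * (5 * n * n) + 9 * a * (n * n) ≡ (5 * q + 9 * a) * (n * n)
    split = identity q n a
      where
      identity : ∀ q n a → q * (5 * n * n) + 9 * a * (n * n) ≡ (5 * q + 9 * a) * (n * n)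
      identity = solve-∀
    5n²≤18m : 5 * n * n ≤ 18 * m
    5n²≤18m = *-cancelˡ-≤ q (≤-trans (m≤m+n (q * (5 * n * n)) (9 * a * (n * n))) (≤-trans (≤-reflexive split) hyp-min))
    δ : ℕ
    δ = 18 * m ∸ 5 * n * n
    18m≡ : 18 * m ≡ 5 * n * n + δ
    18m≡ = sym (m+[n∸m]≡n 5n²≤18m)
    9an²≤qδ : 9 * a * (n * n) ≤ q * δ
    9an²≤qδ = +-cancelˡ-≤ (q * (5 * n * n)) (9 * a * (n * n)) (q * δ) (begin
      q * (5 * n * n) + 9 * a * (n * n) ≡⟨ split ⟩
      (5 * q + 9 * a) * (n * n)         ≤⟨ hyp-min ⟩
      q * (18 * m)                      ≡⟨ cong (q *_) 18m≡ ⟩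
      q * (5 * n * n + δ)               ≡⟨ *-distribˡ-+ q (5 * n * n) δ ⟩
      q * (5 * n * n) + q * δ           ∎)
    square : ∀ a n → 81 * n * (a * a * (n * n * n)) ≡ (9 * a * (n * n)) * (9 * a * (n * n))
    square = solve-∀
    regroup : ∀ q d → (q * d) * (q * d) ≡ q * q * (d * d)
    regroup = solve-∀
    factor : ∀ q n t → q * q * (243 * n * t) ≡ 81 * n * (3 * (q * q) * t)
    factor = solve-∀


open import Defs using (Graph; edges; goodTriples)
open import Data.Nat using (ℕ; suc; zero; s≤s; z≤n)
open import Data.Integer using (+_; +[1+_]; -[1+_]; +<+)
open import Data.Rational using (ℚ; mkℚ; *<*; _/_; _+_; _*_; _≤_; _<_; 0ℚ)
open RationalForm using (edge-hypothesis; triple-conclusion)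
open NaturalForm using (natural-form)

corollary2p6 : (α : ℚ) → 0ℚ < α → (n : ℕ) → (G G' : Graph n) →
    ((+ 5 / 9) + α) * ((+ n / 1) * (+ n / 1)) * (+ 1 / 2) ≤ (+ edges G / 1) →
    ((+ 5 / 9) + α) * ((+ n / 1) * (+ n / 1)) * (+ 1 / 2) ≤ (+ edges G' / 1) →
    α * α * (+ 1 / 3) * ((+ n / 1) * (+ n / 1) * (+ n / 1)) ≤ (+ goodTriples G G' / 1)
corollary2p6 (mkℚ +[1+ a′ ] d c) _ n G G' dense dense' =
  triple-conclusion a′ d c n (goodTriples G G')
    (natural-form G G' (suc a′) (suc d) (s≤s z≤n)
      (edge-hypothesis a′ d c n (edges G) dense)
      (edge-hypothesis a′ d c n (edges G') dense'))
corollary2p6 (mkℚ (+ zero) d c) (*<* (+<+ ())) n G G' _ _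
corollary2p6 (mkℚ -[1+ a ] d c) (*<* ()) n G G' _ _
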